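{- Let $A,B$ be finite alphabets, $\mathbb{K}$ a semiring, $R\colon A^*\to B^*$ a synchronized relation and $S\colon B^*\to\mathbb{K}$ a $\mathbb{K}$-recognizable series, and suppose that for every $u\in A^*$ the language $\{v\in B^*: uRv\}$ is finite. Then the series $S\circ R\colon A^*\to\mathbb{K}$, $u\mapsto\sum_{v\in B^*,\,uRv}(S,v)$, is $\mathbb{K}$-recognizable.
   Context: A relation $R\colon A^*\to B^*$ is identified with its graph $\mathcal{G}_R=\{(u,v)\in A^*\times B^*: uRv\}$. Let $\$\notin A\cup B$. For $(u,v)\in A^*\times B^*$, $(u,v)^\$$ denotes the word over the alphabet $\big((A\cup\{\$\})\times(B\cup\{\$\})\big)\setminus\{(\$,\$)\}$ obtained by padding the shorter of $u,v$ on the left with $\$$'s to the length of the longer one and reading the two words in parallel. $R$ is synchronized if the language $\{(u,v)^\$:(u,v)\in\mathcal{G}_R\}$ is regular. A series $S\colon B^*\to\mathbb{K}$ (coefficients $(S,v)$) is $\mathbb{K}$-recognizable if there exist $r\ge1$, a monoid morphism $\mu\colon B^*\to\mathbb{K}^{r\times r}$, $\lambda\in\mathbb{K}^{1\times r}$, $\gamma\in\mathbb{K}^{r\times1}$ with $(S,v)=\lambda\mu(v)\gamma$ for all $v\in B^*$. -}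

module Defs where

open import Level using (Level; _⊔_)
open import Data.Nat using (ℕ; zero; suc; _∸_; _≤ᵇ_)
open import Data.Fin using (Fin; zero; suc)
open import Data.Bool using (Bool; true; false; if_then_else_)
open import Data.List using (List; []; _∷_; _++_; map; foldr; zipWith; take; drop; length)
open import Data.List.Membership.Propositional using (_∈_)
open import Data.List.Relation.Unary.Unique.Propositional using (Unique)
open import Data.Product using (Σ; ∃; ∃-syntax; _×_; _,_)
open import Function.Bundles using (_↔_; _⇔_)
open import Relation.Binary.PropositionalEquality using (_≡_)
open import Relation.Nullary using (yes; no)
open import Data.Fin using (_≟_)
open import Algebra.Bundles using (Semiring)

Finite : Set → Set
Finite X = ∃[ n ] (X ↔ Fin n)

-- Padded alphabet ((A ∪ {$}) × (B ∪ {$})) ∖ {($,$)}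

data PadLetter (A B : Set) : Set where
  both     : A → B → PadLetter A B
  leftPad  : B → PadLetter A B       -- ($ , b)
  rightPad : A → PadLetter A B       -- (a , $)

-- (u , v)^$ : pad the shorter word on the LEFT with $'s, read in parallel
pad : {A B : Set} → List A → List B → List (PadLetter A B)
pad u v =
  if length u ≤ᵇ length v
  then map leftPad (take (length v ∸ length u) v)
         ++ zipWith both u (drop (length v ∸ length u) v)
  else map rightPad (take (length u ∸ length v) u)
         ++ zipWith both (drop (length u ∸ length v) u) v

record DFA (Σ' : Set) : Set where
  field
    nStates   : ℕ
    start     : Fin nStates
    step      : Fin nStates → Σ' → Fin nStates
    accepting : Fin nStates → Bool

  run : Fin nStates → List Σ' → Fin nStates
  run q []       = q
  run q (x ∷ xs) = run (step q x) xs

  accepts : List Σ' → Bool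
  accepts w = accepting (run start w)

Regular : {ℓ : Level} {Σ' : Set} → (List Σ' → Set ℓ) → Set ℓ
Regular {Σ' = Σ'} L = Σ (DFA Σ') λ M → ∀ w → (DFA.accepts M w ≡ true) ⇔ L w

Rel* : {ℓ : Level} → Set → Set → Set (Level.suc ℓ)
Rel* {ℓ} A B = List A → List B → Set ℓ

padLang : {ℓ : Level} {A B : Set} → Rel* {ℓ} A B → List (PadLetter A B) → Set ℓ
padLang R w = ∃[ u ] ∃[ v ] (R u v × pad u v ≡ w)

Synchronized : {ℓ : Level} {A B : Set} → Rel* {ℓ} A B → Set ℓ
Synchronized R = Regular (padLang R)

FiniteImages : {ℓ : Level} {A B : Set} → Rel* {ℓ} A B → Set ℓ
FiniteImages {B = B} R = ∀ u → ∃[ vs ] (∀ (v : List B) → R u v → v ∈ vs)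

module SemiringDefs {c ℓ : Level} (K : Semiring c ℓ) where
  open Semiring K using (_≈_; _+_; _*_; 0#; 1#) renaming (Carrier to C)

  sumFin : {n : ℕ} → (Fin n → C) → C
  sumFin {zero}  f = 0#
  sumFin {suc n} f = f zero + sumFin (λ i → f (suc i))

  sumList : List C → C
  sumList = foldr _+_ 0#

  Mat : ℕ → Set c
  Mat r = Fin r → Fin r → C

  _⊗_ : {r : ℕ} → Mat r → Mat r → Mat r
  (M ⊗ N) i j = sumFin (λ k → M i k * N k j)

  I : {r : ℕ} → Mat r
  I i j with i ≟ j
  ... | yes _ = 1#
  ... | no _  = 0#

  _≈M_ : {r : ℕ} → Mat r → Mat r → Set ℓ
  M ≈M N = ∀ i j → M i j ≈ N i j

  IsMonoidMorphism : {B : Set} {r : ℕ} → (List B → Mat r) → Set ℓ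
  IsMonoidMorphism {B} μ =
    (μ [] ≈M I) × (∀ (x y : List B) → μ (x ++ y) ≈M (μ x ⊗ μ y))

  bilin : {r : ℕ} → (Fin r → C) → Mat r → (Fin r → C) → C
  bilin lam M gam = sumFin (λ i → sumFin (λ j → lam i * M i j * gam j))

  Series : Set → Set c
  Series B = List B → C

  Recognizable : {B : Set} → Series B → Set (c ⊔ ℓ)
  Recognizable {B} S =
    ∃[ r' ] Σ (List B → Mat (suc r')) λ μ → IsMonoidMorphism μ ×
      Σ (Fin (suc r') → C) λ lam → Σ (Fin (suc r') → C) λ gam →
        ∀ v → S v ≈ bilin lam (μ v) gam

  -- (S ∘ R , u) = Σ_{v : u R v} (S , v), phrased via any duplicate-free
  -- exact enumeration of the finite set { v : u R v }.
  IsComposition : {ℓR : Level} {A B : Set} →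
    Series B → Rel* {ℓR} A B → Series A → Set (ℓ ⊔ ℓR)
  IsComposition {B = B} S R T =
    ∀ u (vs : List (List B)) → Unique vs → (∀ v → (v ∈ vs) ⇔ R u v) →
      T u ≈ sumList (map S vs)

-- Read u while guessing v letter by letter: the guessing automaton runs the DFA of the padded
-- graph (u , v)^$ alongside a linear representation of S, so each guess v contributes
-- (S , v) exactly when u R v, and the sum over all guesses is (S ∘ R , u). Since padding is on
-- the left, either the first |u| − |v| letters of u are read against $ (the states `waiting`), or
-- v begins with a prefix read against $, which the initial vector sums over. That prefix has
-- length at most the number of DFA states, for a longer one could be pumped into infinitely many
-- images of u; hence finitely many guesses suffice and the automaton has finitely many states.

module Submission where

open import Defs
open import Level using (Level)
open import Data.Product using (Σ; _×_; _,_)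
open import Algebra.Bundles using (Semiring)
open import Data.Bool using (true)
open import Data.Nat using (ℕ; suc)
open import Data.Fin using (Fin)
open import Data.List using (List)
open import Function.Bundles using (_⇔_)
open import Relation.Binary.PropositionalEquality using (_≡_)

module FiniteSums {c ℓ : Level} (K : Semiring c ℓ) where

  open import Function using (id; _∘_)
  open import Data.Bool using (Bool; false)
  open import Data.Nat using (zero)
  open import Data.Fin using (zero; suc)
  open import Data.List using ([]; _∷_; _++_; map; cartesianProductWith; tabulate; allFin; filter)
  import Data.List.Properties as List
  open import Data.List.Membership.Propositional using (_∈_)
  open import Data.List.Relation.Unary.Any using (here; there)
  open import Data.List.Relation.Binary.Permutation.Propositional using (_↭_; ↭⇒↭ₛ′)
  open import Data.List.Relation.Binary.Permutation.Propositional.Properties using (map⁺)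
  open import Relation.Nullary.Decidable using (T?)
  import Relation.Binary.PropositionalEquality as ≡

  open Semiring K hiding (zero) renaming (Carrier to C)
  open SemiringDefs K
  open import Algebra.Properties.CommutativeSemigroup +-commutativeSemigroup using (interchange)
  open import Data.List.Relation.Binary.Permutation.Setoid.Properties setoid using (foldr-commMonoid)
  open import Relation.Binary.Reasoning.Setoid setoid

  private variable
    a : Level
    X Y Z : Set a
    n : ℕ

  ∑ᴸ : List X → (X → C) → C
  ∑ᴸ xs f = sumList (map f xs)

  infix 5 ∑ᴸ
  syntax ∑ᴸ xs (λ x → e) = ∑[ x ∈ xs ] e

  𝟙 : Bool → C
  𝟙 true  = 1#
  𝟙 false = 0#

  ∑ᴸ-cong : (xs : List X) {f g : X → C} → (∀ {x} → x ∈ xs → f x ≈ g x) → ∑ᴸ xs f ≈ ∑ᴸ xs g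
  ∑ᴸ-cong []       _   = refl
  ∑ᴸ-cong (x ∷ xs) f≈g = +-cong (f≈g (here ≡.refl)) (∑ᴸ-cong xs λ x∈ → f≈g (there x∈))

  ∑ᴸ-++ : (xs ys : List X) (f : X → C) → ∑ᴸ (xs ++ ys) f ≈ ∑ᴸ xs f + ∑ᴸ ys f
  ∑ᴸ-++ []       ys f = sym (+-identityˡ _)
  ∑ᴸ-++ (x ∷ xs) ys f = trans (+-congˡ (∑ᴸ-++ xs ys f)) (sym (+-assoc _ _ _))

  ∑ᴸ-0 : (xs : List X) → ∑[ x ∈ xs ] 0# ≈ 0#
  ∑ᴸ-0 []       = refl
  ∑ᴸ-0 (x ∷ xs) = trans (+-identityˡ _) (∑ᴸ-0 xs)

  ∑ᴸ-+ : (xs : List X) (f g : X → C) → ∑[ x ∈ xs ] (f x + g x) ≈ ∑ᴸ xs f + ∑ᴸ xs g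
  ∑ᴸ-+ []       f g = sym (+-identityˡ _)
  ∑ᴸ-+ (x ∷ xs) f g = trans (+-congˡ (∑ᴸ-+ xs f g)) (interchange _ _ _ _)

  *-distribˡ-∑ᴸ : (z : C) (xs : List X) (f : X → C) → z * ∑ᴸ xs f ≈ ∑[ x ∈ xs ] z * f x
  *-distribˡ-∑ᴸ z []       f = zeroʳ z
  *-distribˡ-∑ᴸ z (x ∷ xs) f = trans (distribˡ z _ _) (+-congˡ (*-distribˡ-∑ᴸ z xs f))

  *-distribʳ-∑ᴸ : (z : C) (xs : List X) (f : X → C) → ∑ᴸ xs f * z ≈ ∑[ x ∈ xs ] f x * z
  *-distribʳ-∑ᴸ z []       f = zeroˡ z
  *-distribʳ-∑ᴸ z (x ∷ xs) f = trans (distribʳ z _ _) (+-congˡ (*-distribʳ-∑ᴸ z xs f))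

  ∑ᴸ-cartesianProductWith : (h : X → Y → Z) (xs : List X) (ys : List Y) (f : Z → C) →
    ∑ᴸ (cartesianProductWith h xs ys) f ≈ ∑[ x ∈ xs ] ∑[ y ∈ ys ] f (h x y)
  ∑ᴸ-cartesianProductWith h []       ys f = refl
  ∑ᴸ-cartesianProductWith h (x ∷ xs) ys f = begin
    ∑ᴸ (map (h x) ys ++ cartesianProductWith h xs ys) f
      ≈⟨ ∑ᴸ-++ (map (h x) ys) _ f ⟩
    ∑ᴸ (map (h x) ys) f + ∑ᴸ (cartesianProductWith h xs ys) f
      ≈⟨ +-cong (reflexive (≡.cong sumList (≡.sym (List.map-∘ ys))))
                (∑ᴸ-cartesianProductWith h xs ys f) ⟩
    (∑[ y ∈ ys ] f (h x y)) + (∑[ x ∈ xs ] ∑[ y ∈ ys ] f (h x y)) ∎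

  ∑ᴸ-tabulate : (g : Fin n → X) (f : X → C) → ∑ᴸ (tabulate g) f ≡ sumFin (f ∘ g)
  ∑ᴸ-tabulate {zero}  g f = ≡.refl
  ∑ᴸ-tabulate {suc n} g f = ≡.cong (f (g zero) +_) (∑ᴸ-tabulate (g ∘ suc) f)

  ∑ᴸ-allFin : (f : Fin n → C) → ∑ᴸ (allFin n) f ≡ sumFin f
  ∑ᴸ-allFin = ∑ᴸ-tabulate id

  ∑ᴸ-filter : (p : X → Bool) (xs : List X) (f : X → C) →
    ∑[ x ∈ xs ] f x * 𝟙 (p x) ≈ ∑ᴸ (filter (T? ∘ p) xs) f
  ∑ᴸ-filter p []       f = refl
  ∑ᴸ-filter p (x ∷ xs) f with p x
  ... | true  = +-cong (*-identityʳ _) (∑ᴸ-filter p xs f)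
  ... | false = trans (+-cong (zeroʳ _) (∑ᴸ-filter p xs f)) (+-identityˡ _)

  ∑ᴸ-↭ : {xs ys : List X} (f : X → C) → xs ↭ ys → ∑ᴸ xs f ≈ ∑ᴸ ys f
  ∑ᴸ-↭ f xs↭ys = foldr-commMonoid +-isCommutativeMonoid (↭⇒↭ₛ′ isEquivalence (map⁺ f xs↭ys))

  sumFin-cong : {f g : Fin n → C} → (∀ i → f i ≈ g i) → sumFin f ≈ sumFin g
  sumFin-cong {zero}  _   = refl
  sumFin-cong {suc n} f≈g = +-cong (f≈g zero) (sumFin-cong (f≈g ∘ suc))

  sumFin-0 : sumFin {n} (λ _ → 0#) ≈ 0#
  sumFin-0 {zero}  = refl
  sumFin-0 {suc n} = trans (+-identityˡ _) (sumFin-0 {n})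

  sumFin-+ : (f g : Fin n → C) → sumFin (λ i → f i + g i) ≈ sumFin f + sumFin g
  sumFin-+ {zero}  f g = sym (+-identityˡ _)
  sumFin-+ {suc n} f g = trans (+-congˡ (sumFin-+ (f ∘ suc) (g ∘ suc))) (interchange _ _ _ _)

  *-distribˡ-sumFin : (z : C) (f : Fin n → C) → z * sumFin f ≈ sumFin (λ i → z * f i)
  *-distribˡ-sumFin {zero}  z f = zeroʳ z
  *-distribˡ-sumFin {suc n} z f = trans (distribˡ z _ _) (+-congˡ (*-distribˡ-sumFin z (f ∘ suc)))

  *-distribʳ-sumFin : (z : C) (f : Fin n → C) → sumFin f * z ≈ sumFin (λ i → f i * z)
  *-distribʳ-sumFin {zero}  z f = zeroˡ z
  *-distribʳ-sumFin {suc n} z f = trans (distribʳ z _ _) (+-congˡ (*-distribʳ-sumFin z (f ∘ suc)))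

  sumFin-comm : {m : ℕ} (f : Fin n → Fin m → C) →
    sumFin (λ i → sumFin (f i)) ≈ sumFin (λ j → sumFin (λ i → f i j))
  sumFin-comm {zero}  {m} f = sym (sumFin-0 {m})
  sumFin-comm {suc n}     f = trans (+-congˡ (sumFin-comm (f ∘ suc))) (sym (sumFin-+ (f zero) _))

  sumFin-∑ᴸ-comm : (xs : List X) (f : Fin n → X → C) →
    sumFin (λ i → ∑ᴸ xs (f i)) ≈ ∑[ x ∈ xs ] sumFin (λ i → f i x)
  sumFin-∑ᴸ-comm {n = zero}  xs f = sym (∑ᴸ-0 xs)
  sumFin-∑ᴸ-comm {n = suc n} xs f =
    trans (+-congˡ (sumFin-∑ᴸ-comm xs (f ∘ suc))) (sym (∑ᴸ-+ xs (f zero) _))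

module Matrices {c ℓ : Level} (K : Semiring c ℓ) where

  open import Function using (_∘_)
  open import Data.Nat using (zero)
  open import Data.Fin using (zero; suc; _≟_)
  open import Relation.Nullary using (yes; no)

  open Semiring K hiding (zero) renaming (Carrier to C)
  open SemiringDefs K
  open FiniteSums K
  open import Relation.Binary.Reasoning.Setoid setoid

  private variable
    a : Level
    X : Set a
    n : ℕ

  infix  8 _·_
  infixr 7 _▷_
  infixl 7 _◁_

  _·_ : (Fin n → C) → (Fin n → C) → C
  u · v = sumFin (λ i → u i * v i)

  _▷_ : Mat n → (Fin n → C) → Fin n → C
  (M ▷ v) i = M i · v

  _◁_ : (Fin n → C) → Mat n → Fin n → C
  (u ◁ M) j = sumFin (λ i → u i * M i j)

  ·-cong : {u u′ v v′ : Fin n → C} → (∀ i → u i ≈ u′ i) → (∀ i → v i ≈ v′ i) → u · v ≈ u′ · v′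
  ·-cong {n} u≈u′ v≈v′ = sumFin-cong {n} λ i → *-cong (u≈u′ i) (v≈v′ i)

  ·-congʳ : (u : Fin n → C) {v v′ : Fin n → C} → (∀ i → v i ≈ v′ i) → u · v ≈ u · v′
  ·-congʳ u = ·-cong (λ _ → refl)

  ◁-· : (u : Fin n → C) (M : Mat n) (v : Fin n → C) → (u ◁ M) · v ≈ u · (M ▷ v)
  ◁-· {n} u M v = begin
    sumFin (λ j → sumFin (λ i → u i * M i j) * v j)
      ≈⟨ sumFin-cong {n} (λ j → *-distribʳ-sumFin {n} (v j) _) ⟩
    sumFin (λ j → sumFin (λ i → u i * M i j * v j))
      ≈⟨ sumFin-comm {n} {n} _ ⟨
    sumFin (λ i → sumFin (λ j → u i * M i j * v j))
      ≈⟨ sumFin-cong {n} (λ i → trans (sumFin-cong {n} λ _ → *-assoc _ _ _)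
                                     (sym (*-distribˡ-sumFin {n} (u i) _))) ⟩
    sumFin (λ i → u i * sumFin (λ j → M i j * v j)) ∎

  -- K need not be commutative, so scalars that must pass through a sum are kept on the right.
  ·-distrib-∑ᴸ : (ρ : Fin n → C) (xs : List X) (g : X → Fin n → C) (h : X → C) →
    ρ · (λ k → ∑[ x ∈ xs ] g x k * h x) ≈ ∑[ x ∈ xs ] (ρ · g x) * h x
  ·-distrib-∑ᴸ {n = n} ρ xs g h = begin
    sumFin (λ k → ρ k * (∑[ x ∈ xs ] g x k * h x))
      ≈⟨ sumFin-cong {n} (λ k → trans (*-distribˡ-∑ᴸ (ρ k) xs _) (∑ᴸ-cong xs λ _ → sym (*-assoc _ _ _))) ⟩
    sumFin (λ k → ∑[ x ∈ xs ] ρ k * g x k * h x)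
      ≈⟨ sumFin-∑ᴸ-comm {n = n} xs _ ⟩
    ∑[ x ∈ xs ] sumFin (λ k → ρ k * g x k * h x)
      ≈⟨ ∑ᴸ-cong xs (λ _ → sym (*-distribʳ-sumFin {n} _ _)) ⟩
    ∑[ x ∈ xs ] (ρ · g x) * h x ∎

  I-· : (i : Fin n) (v : Fin n → C) → I i · v ≈ v i
  I-· {suc n} zero    v = begin
    1# * v zero + sumFin (λ j → 0# * v (suc j)) ≈⟨ +-cong (*-identityˡ _) (sumFin-cong {n} λ _ → zeroˡ _) ⟩
    v zero + sumFin {n} (λ _ → 0#)              ≈⟨ trans (+-congˡ (sumFin-0 {n})) (+-identityʳ _) ⟩
    v zero                                       ∎
  I-· {suc n} (suc i) v = begin
    0# * v zero + sumFin (λ j → I (suc i) (suc j) * v (suc j)) ≈⟨ +-cong (zeroˡ _) (sumFin-cong {n} I-suc) ⟩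
    0# + I i · (v ∘ suc)                                        ≈⟨ +-identityˡ _ ⟩
    I i · (v ∘ suc)                                             ≈⟨ I-· i (v ∘ suc) ⟩
    v (suc i)                                                   ∎
    where
    I-suc : ∀ j → I (suc i) (suc j) * v (suc j) ≈ I i j * v (suc j)
    I-suc j with i ≟ j
    ... | yes _ = refl
    ... | no  _ = refl

  ⊗-cong : {M M′ N N′ : Mat n} → M ≈M M′ → N ≈M N′ → (M ⊗ N) ≈M (M′ ⊗ N′)
  ⊗-cong M≈M′ N≈N′ i j = ·-cong (M≈M′ i) (λ k → N≈N′ k j)

  ⊗-assoc : (M N P : Mat n) → ((M ⊗ N) ⊗ P) ≈M (M ⊗ (N ⊗ P))
  ⊗-assoc M N P i j = ◁-· (M i) N (λ k → P k j)

  I-⊗ : (M : Mat n) → (I ⊗ M) ≈M M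
  I-⊗ M i j = I-· i (λ k → M k j)

  ▷-congˡ : {M M′ : Mat n} → M ≈M M′ → ∀ v i → (M ▷ v) i ≈ (M′ ▷ v) i
  ▷-congˡ M≈M′ v i = ·-cong (M≈M′ i) (λ _ → refl)

  ⊗-▷ : (M N : Mat n) (v : Fin n → C) → ∀ i → ((M ⊗ N) ▷ v) i ≈ (M ▷ N ▷ v) i
  ⊗-▷ M N v i = ◁-· (M i) N v

  bilin-· : (u : Fin n → C) (M : Mat n) (v : Fin n → C) → bilin u M v ≈ u · (M ▷ v)
  bilin-· {n} u M v = sumFin-cong {n} λ i →
    trans (sumFin-cong {n} λ _ → *-assoc _ _ _) (sym (*-distribˡ-sumFin {n} (u i) _))

module WeightedAutomata {c ℓ : Level} (K : Semiring c ℓ) where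

  open import Function using (_∘_)
  open import Data.Product using (proj₁; proj₂)
  open import Data.List using ([]; _∷_; _++_; length; lookup)
  open import Data.List.Membership.Propositional using (_∈_)
  open import Data.List.Relation.Unary.Any using (index)
  open import Data.List.Relation.Unary.Any.Properties using (lookup-index)
  import Relation.Binary.PropositionalEquality as ≡

  open Semiring K hiding (zero) renaming (Carrier to C)
  open SemiringDefs K
  open FiniteSums K
  open Matrices K
  open import Relation.Binary.Reasoning.Setoid setoid

  weighted : {a : Level} {X : Set a} → (X → C) → C × X → C
  weighted f p = proj₁ p * f (proj₂ p)

  -- The states are enumerated by the nonempty list x₀ ∷ xs, as Recognizable asks for suc r states.
  module Automaton {A X : Set} (x₀ : X) (xs : List X) (complete : ∀ x → x ∈ x₀ ∷ xs)
                   (δ : A → X → List (C × X)) (final : X → C) (initial : List (C × X)) where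

    future : List A → X → C
    future []      x = final x
    future (a ∷ u) x = ∑ᴸ (δ a x) (weighted (future u))

    behaviour : List A → C
    behaviour u = ∑ᴸ initial (weighted (future u))

    private
      n = length xs

      state : Fin (suc n) → X
      state = lookup (x₀ ∷ xs)

      index-of : X → Fin (suc n)
      index-of x = index (complete x)

      state-index-of : ∀ x → state (index-of x) ≡ x
      state-index-of x = ≡.sym (lookup-index (complete x))

      vec : List (C × X) → Fin (suc n) → C
      vec ps j = ∑ᴸ ps (weighted λ y → I (index-of y) j)

      vec-· : (ps : List (C × X)) (f : X → C) → vec ps · (f ∘ state) ≈ ∑ᴸ ps (weighted f)
      vec-· ps f = begin
        sumFin (λ j → ∑ᴸ ps (weighted λ y → I (index-of y) j) * f (state j))
          ≈⟨ sumFin-cong {suc n} (λ j → *-distribʳ-∑ᴸ (f (state j)) ps (weighted λ y → I (index-of y) j)) ⟩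
        sumFin (λ j → ∑[ p ∈ ps ] proj₁ p * I (index-of (proj₂ p)) j * f (state j))
          ≈⟨ sumFin-∑ᴸ-comm ps (λ j p → proj₁ p * I (index-of (proj₂ p)) j * f (state j)) ⟩
        ∑[ p ∈ ps ] sumFin (λ j → proj₁ p * I (index-of (proj₂ p)) j * f (state j))
          ≈⟨ ∑ᴸ-cong ps (λ {p} _ → picks-state p) ⟩
        ∑ᴸ ps (weighted f) ∎
        where
        picks-state : ∀ p → sumFin (λ j → proj₁ p * I (index-of (proj₂ p)) j * f (state j)) ≈ weighted f p
        picks-state (w , y) = begin
          sumFin (λ j → w * I (index-of y) j * f (state j))
            ≈⟨ sumFin-cong {suc n} (λ j → *-assoc w (I (index-of y) j) (f (state j))) ⟩
          sumFin (λ j → w * (I (index-of y) j * f (state j)))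
            ≈⟨ *-distribˡ-sumFin w (λ j → I (index-of y) j * f (state j)) ⟨
          w * (I (index-of y) · (f ∘ state))
            ≈⟨ *-congˡ (I-· (index-of y) (f ∘ state)) ⟩
          w * f (state (index-of y))
            ≈⟨ *-congˡ (reflexive (≡.cong f (state-index-of y))) ⟩
          w * f y ∎

      transition : A → Mat (suc n)
      transition a i = vec (δ a (state i))

      μ : List A → Mat (suc n)
      μ []      = I
      μ (a ∷ u) = transition a ⊗ μ u

      μ-++ : (u v : List A) → μ (u ++ v) ≈M (μ u ⊗ μ v)
      μ-++ []      v = λ i j → sym (I-⊗ (μ v) i j)
      μ-++ (a ∷ u) v = λ i j → trans (⊗-cong {M = transition a} (λ _ _ → refl) (μ-++ u v) i j)
                                     (sym (⊗-assoc (transition a) (μ u) (μ v) i j))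

      μ▷final : ∀ u i → (μ u ▷ final ∘ state) i ≈ future u (state i)
      μ▷final []      i = I-· i (final ∘ state)
      μ▷final (a ∷ u) i = begin
        ((transition a ⊗ μ u) ▷ final ∘ state) i ≈⟨ ⊗-▷ (transition a) (μ u) (final ∘ state) i ⟩
        transition a i · (μ u ▷ final ∘ state)   ≈⟨ ·-congʳ (transition a i) (μ▷final u) ⟩
        transition a i · (future u ∘ state)      ≈⟨ vec-· (δ a (state i)) (future u) ⟩
        future (a ∷ u) (state i)                 ∎

      behaviour≈bilin : ∀ u → behaviour u ≈ bilin (vec initial) (μ u) (final ∘ state)
      behaviour≈bilin u = sym (begin
        bilin (vec initial) (μ u) (final ∘ state) ≈⟨ bilin-· (vec initial) (μ u) (final ∘ state) ⟩
        vec initial · (μ u ▷ final ∘ state)       ≈⟨ ·-congʳ (vec initial) (μ▷final u) ⟩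
        vec initial · (future u ∘ state)          ≈⟨ vec-· initial (future u) ⟩
        behaviour u                               ∎)

    behaviour-recognizable : Recognizable behaviour
    behaviour-recognizable = n , μ , ((λ _ _ → refl) , μ-++) , vec initial , final ∘ state , behaviour≈bilin

module Enumerations where

  open import Data.Nat using (zero; _≤_)
  import Data.Nat.Properties as ℕ
  open import Data.Sum using (inj₁; inj₂)
  open import Data.List using ([]; _∷_; _++_; map; allFin; length; cartesianProductWith)
  import Data.List.Properties as List
  open import Data.List.Membership.Propositional using (_∈_)
  open import Data.List.Membership.Propositional.Properties
    using (∈-map⁺; ∈-allFin; ∈-++⁺ˡ; ∈-++⁺ʳ; ∈-++⁻; ∈-cartesianProductWith⁺; ∈-cartesianProductWith⁻)
  open import Data.List.Relation.Unary.Any using (here)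
  open import Data.List.Relation.Unary.Unique.Propositional using (Unique)
  import Data.List.Relation.Unary.Unique.Propositional.Properties as Unique
  import Data.List.Relation.Unary.All as All
  import Data.List.Relation.Unary.AllPairs as AllPairs
  open import Function.Bundles using (Inverse)
  open import Relation.Binary.PropositionalEquality using (refl; sym; trans; cong; subst)

  finite⇒enumeration : {X : Set} → Finite X → Σ (List X) λ xs → Unique xs × (∀ x → x ∈ xs)
  finite⇒enumeration (n , X↔Fin) = map from (allFin n) , unique , complete
    where
    open Inverse X↔Fin
    unique : Unique (map from (allFin n))
    unique = Unique.map⁺ (λ {i} {j} eq → trans (sym (strictlyInverseˡ i))
                                         (trans (cong to eq) (strictlyInverseˡ j)))
                         (Unique.allFin⁺ n)
    complete : ∀ x → x ∈ map from (allFin n)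
    complete x = subst (_∈ _) (strictlyInverseʳ x) (∈-map⁺ from (∈-allFin (to x)))

  module Words {B : Set} (bs : List B) (bs-unique : Unique bs) (bs-complete : ∀ b → b ∈ bs) where

    words : ℕ → List (List B)
    words zero    = [] ∷ []
    words (suc n) = cartesianProductWith _∷_ bs (words n)

    wordsUpTo : ℕ → List (List B)
    wordsUpTo zero    = words zero
    wordsUpTo (suc n) = wordsUpTo n ++ words (suc n)

    ∈-words⁻ : ∀ n {v} → v ∈ words n → length v ≡ n
    ∈-words⁻ zero    (here refl) = refl
    ∈-words⁻ (suc n) v∈ with ∈-cartesianProductWith⁻ _∷_ bs (words n) v∈
    ... | _ , _ , _ , w∈ , refl = cong suc (∈-words⁻ n w∈)

    ∈-words⁺ : ∀ v → v ∈ words (length v)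
    ∈-words⁺ []      = here refl
    ∈-words⁺ (b ∷ v) = ∈-cartesianProductWith⁺ _∷_ (bs-complete b) (∈-words⁺ v)

    words-unique : ∀ n → Unique (words n)
    words-unique zero    = All.[] AllPairs.∷ AllPairs.[]
    words-unique (suc n) = Unique.cartesianProductWith⁺ _∷_ List.∷-injective bs-unique (words-unique n)

    ∈-wordsUpTo⁻ : ∀ n {v} → v ∈ wordsUpTo n → length v ≤ n
    ∈-wordsUpTo⁻ zero    v∈ = ℕ.≤-reflexive (∈-words⁻ zero v∈)
    ∈-wordsUpTo⁻ (suc n) v∈ with ∈-++⁻ (wordsUpTo n) v∈
    ... | inj₁ v∈ˡ = ℕ.m≤n⇒m≤1+n (∈-wordsUpTo⁻ n v∈ˡ)
    ... | inj₂ v∈ʳ = ℕ.≤-reflexive (∈-words⁻ (suc n) v∈ʳ)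

    ∈-wordsUpTo⁺ : ∀ n {v} → length v ≤ n → v ∈ wordsUpTo n
    ∈-wordsUpTo⁺ zero    {v} v≤0 = subst (λ m → v ∈ words m) (ℕ.n≤0⇒n≡0 v≤0) (∈-words⁺ v)
    ∈-wordsUpTo⁺ (suc n) {v} v≤ with ℕ.m≤n⇒m<n∨m≡n v≤
    ... | inj₁ v<  = ∈-++⁺ˡ (∈-wordsUpTo⁺ n (ℕ.≤-pred v<))
    ... | inj₂ v≡  = ∈-++⁺ʳ (wordsUpTo n) (subst (λ m → v ∈ words m) v≡ (∈-words⁺ v))

    wordsUpTo-unique : ∀ n → Unique (wordsUpTo n)
    wordsUpTo-unique zero    = words-unique zero
    wordsUpTo-unique (suc n) = Unique.++⁺ (wordsUpTo-unique n) (words-unique (suc n))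
      λ (v∈ˡ , v∈ʳ) → ℕ.1+n≰n (subst (_≤ n) (∈-words⁻ (suc n) v∈ʳ) (∈-wordsUpTo⁻ n v∈ˡ))

module ListLengths where

  open import Data.Nat using (zero; _+_; _∸_; _≤_; _<_; z≤n)
  import Data.Nat.Properties as ℕ
  open import Data.Product using (∃₂; ∃-syntax)
  open import Data.List using ([]; _∷_; _++_; take; drop; length; concat; replicate)
  import Data.List.Properties as List
  open import Data.List.Membership.Propositional using (_∈_)
  open import Data.List.Relation.Unary.Any using (here; there)
  open import Relation.Binary.PropositionalEquality using (refl; sym; trans; cong; subst)

  private variable
    X Y : Set

  take-length-++ : (w v : List X) → take (length w) (w ++ v) ≡ w
  take-length-++ []      v = refl
  take-length-++ (x ∷ w) v = cong (x ∷_) (take-length-++ w v)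

  drop-length-++ : (w v : List X) → drop (length w) (w ++ v) ≡ v
  drop-length-++ []      v = refl
  drop-length-++ (x ∷ w) v = drop-length-++ w v

  suffix-of-length : (u : List X) (v : List Y) → length u ≤ length v →
    ∃₂ λ w v′ → v ≡ w ++ v′ × length v′ ≡ length u
  suffix-of-length u v u≤v =
    take k v , drop k v , sym (List.take++drop≡id k v) , trans (List.length-drop k v) (ℕ.m∸[m∸n]≡n u≤v)
    where k = length v ∸ length u

  prefix-longer : ∀ n (w v : List X) {m} → n + m < length (w ++ v) → length v ≡ m → n < length w
  prefix-longer n w v {m} long v≡m = ℕ.+-cancelʳ-< m n (length w)
    (subst (n + m <_) (trans (List.length-++ w) (cong (length w +_) v≡m)) long)

  infix-length : (x y z : List X) → length y ≤ length (x ++ y ++ z)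
  infix-length x y z = begin
    length y                   ≤⟨ ℕ.m≤m+n (length y) (length z) ⟩
    length y + length z        ≡⟨ List.length-++ y ⟨
    length (y ++ z)            ≤⟨ ℕ.m≤n+m (length (y ++ z)) (length x) ⟩
    length x + length (y ++ z) ≡⟨ List.length-++ x ⟨
    length (x ++ y ++ z)       ∎
    where open ℕ.≤-Reasoning

  length-concat-replicate : (k : ℕ) (y : List X) → 0 < length y → k ≤ length (concat (replicate k y))
  length-concat-replicate zero    y _   = z≤n
  length-concat-replicate (suc k) y 0<y = subst (suc k ≤_) (sym (List.length-++ y))
    (ℕ.+-mono-≤ 0<y (length-concat-replicate k y 0<y))

  lengths-bounded : (vs : List (List X)) → ∃[ m ] (∀ {v} → v ∈ vs → length v ≤ m)
  lengths-bounded []       = 0 , λ ()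
  lengths-bounded (v ∷ vs) with lengths-bounded vs
  ... | m , bound = length v + m , λ where
    (here refl) → ℕ.m≤m+n (length v) m
    (there v∈)  → ℕ.≤-trans (bound v∈) (ℕ.m≤n+m m (length v))

module Padding {A B : Set} where

  open import Data.Bool using (Bool; false; T; if_then_else_)
  open import Data.Unit using (tt)
  open import Data.Empty using (⊥-elim)
  open import Data.Nat using (_+_; _∸_; _≤_; _<_; s≤s)
  import Data.Nat.Properties as ℕ
  open import Data.Sum using (inj₁; inj₂)
  open import Data.List using ([]; _∷_; _++_; map; zipWith; take; drop; length)
  import Data.List.Properties as List
  open import Relation.Nullary using (¬_)
  open import Relation.Binary.PropositionalEquality
    using (_≡_; refl; sym; trans; cong; cong₂; subst; module ≡-Reasoning)
  open ListLengths
  open ≡-Reasoning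

  private
    if-true : {X : Set} {b : Bool} {x y : X} → T b → (if b then x else y) ≡ x
    if-true {b = true} _ = refl

    if-false : {X : Set} {b : Bool} {x y : X} → ¬ T b → (if b then x else y) ≡ y
    if-false {b = true}  ¬t = ⊥-elim (¬t tt)
    if-false {b = false} _  = refl

  pad-leftPad : (u : List A) (w v : List B) → length v ≡ length u →
    pad u (w ++ v) ≡ map leftPad w ++ zipWith both u v
  pad-leftPad u w v v≡u = begin
    pad u (w ++ v)
      ≡⟨ if-true (ℕ.≤⇒≤ᵇ (subst (length u ≤_) (sym length-wv) (ℕ.m≤n+m (length u) (length w)))) ⟩
    map leftPad (take k (w ++ v)) ++ zipWith both u (drop k (w ++ v))
      ≡⟨ cong (λ m → map leftPad (take m (w ++ v)) ++ zipWith both u (drop m (w ++ v))) k≡w ⟩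
    map leftPad (take (length w) (w ++ v)) ++ zipWith both u (drop (length w) (w ++ v))
      ≡⟨ cong₂ (λ w′ v′ → map leftPad w′ ++ zipWith both u v′) (take-length-++ w v) (drop-length-++ w v) ⟩
    map leftPad w ++ zipWith both u v ∎
    where
    k = length (w ++ v) ∸ length u
    length-wv : length (w ++ v) ≡ length w + length u
    length-wv = trans (List.length-++ w) (cong (length w +_) v≡u)
    k≡w : k ≡ length w
    k≡w = trans (cong (_∸ length u) length-wv) (ℕ.m+n∸n≡m (length w) (length u))

  pad-rightPad : (x u : List A) (v : List B) → length v ≡ length u →
    pad (x ++ u) v ≡ map rightPad x ++ zipWith both u v
  pad-rightPad []      u v v≡u = pad-leftPad u [] v v≡u
  pad-rightPad (a ∷ x) u v v≡u = begin
    pad xu v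
      ≡⟨ if-false (λ t → ℕ.<⇒≱ v<xu (ℕ.≤ᵇ⇒≤ (length xu) (length v) t)) ⟩
    map rightPad (take k xu) ++ zipWith both (drop k xu) v
      ≡⟨ cong (λ m → map rightPad (take m xu) ++ zipWith both (drop m xu) v) k≡ax ⟩
    map rightPad (take (length (a ∷ x)) xu) ++ zipWith both (drop (length (a ∷ x)) xu) v
      ≡⟨ cong₂ (λ x′ u′ → map rightPad x′ ++ zipWith both u′ v) (take-length-++ (a ∷ x) u) (drop-length-++ (a ∷ x) u) ⟩
    map rightPad (a ∷ x) ++ zipWith both u v ∎
    where
    xu = a ∷ x ++ u
    k = length xu ∸ length v
    length-xu : length xu ≡ length (a ∷ x) + length v
    length-xu = trans (List.length-++ (a ∷ x)) (cong (length (a ∷ x) +_) (sym v≡u))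
    v<xu : length v < length xu
    v<xu = subst (length v <_) (sym length-xu) (s≤s (ℕ.m≤n+m (length v) (length x)))
    k≡ax : k ≡ length (a ∷ x)
    k≡ax = trans (cong (_∸ length v) length-xu) (ℕ.m+n∸n≡m (length (a ∷ x)) (length v))

  pad-∷-rightPad : (a : A) (u : List A) (v : List B) → length v ≤ length u →
    pad (a ∷ u) v ≡ rightPad a ∷ pad u v
  pad-∷-rightPad a u v v≤u with suffix-of-length v u v≤u
  ... | x , u′ , refl , u′≡v =
    trans (pad-rightPad (a ∷ x) u′ v (sym u′≡v)) (cong (rightPad a ∷_) (sym (pad-rightPad x u′ v (sym u′≡v))))

  unpadˡ : List (PadLetter A B) → List A
  unpadˡ []               = []
  unpadˡ (both a _ ∷ w)   = a ∷ unpadˡ w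
  unpadˡ (leftPad _ ∷ w)  = unpadˡ w
  unpadˡ (rightPad a ∷ w) = a ∷ unpadˡ w

  unpadʳ : List (PadLetter A B) → List B
  unpadʳ []               = []
  unpadʳ (both _ b ∷ w)   = b ∷ unpadʳ w
  unpadʳ (leftPad b ∷ w)  = b ∷ unpadʳ w
  unpadʳ (rightPad _ ∷ w) = unpadʳ w

  unpad-zipWith : (u : List A) (v : List B) → length v ≡ length u →
    unpadˡ (zipWith both u v) ≡ u × unpadʳ (zipWith both u v) ≡ v
  unpad-zipWith []      []      _     = refl , refl
  unpad-zipWith (a ∷ u) (b ∷ v) v≡u with unpad-zipWith u v (ℕ.suc-injective v≡u)
  ... | eqˡ , eqʳ = cong (a ∷_) eqˡ , cong (b ∷_) eqʳ

  unpad-leftPad : (w : List B) (u : List A) (v : List B) → length v ≡ length u →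
    unpadˡ (map leftPad w ++ zipWith both u v) ≡ u × unpadʳ (map leftPad w ++ zipWith both u v) ≡ w ++ v
  unpad-leftPad []      u v v≡u = unpad-zipWith u v v≡u
  unpad-leftPad (b ∷ w) u v v≡u with unpad-leftPad w u v v≡u
  ... | eqˡ , eqʳ = eqˡ , cong (b ∷_) eqʳ

  unpad-rightPad : (x u : List A) (v : List B) → length v ≡ length u →
    unpadˡ (map rightPad x ++ zipWith both u v) ≡ x ++ u × unpadʳ (map rightPad x ++ zipWith both u v) ≡ v
  unpad-rightPad []      u v v≡u = unpad-zipWith u v v≡u
  unpad-rightPad (a ∷ x) u v v≡u with unpad-rightPad x u v v≡u
  ... | eqˡ , eqʳ = cong (a ∷_) eqˡ , eqʳ

  unpad-pad : (u : List A) (v : List B) → unpadˡ (pad u v) ≡ u × unpadʳ (pad u v) ≡ v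
  unpad-pad u v with ℕ.≤-total (length u) (length v)
  ... | inj₁ u≤v with suffix-of-length u v u≤v
  ...   | w , v′ , refl , v′≡u rewrite pad-leftPad u w v′ v′≡u = unpad-leftPad w u v′ v′≡u
  unpad-pad u v | inj₂ v≤u with suffix-of-length v u v≤u
  ...   | x , u′ , refl , u′≡v rewrite pad-rightPad x u′ v (sym u′≡v) = unpad-rightPad x u′ v (sym u′≡v)

  pad-injective : {u u′ : List A} {v v′ : List B} → pad u v ≡ pad u′ v′ → u ≡ u′ × v ≡ v′
  pad-injective {u} {u′} {v} {v′} eq with unpad-pad u v | unpad-pad u′ v′
  ... | eqˡ , eqʳ | eqˡ′ , eqʳ′ =
    trans (sym eqˡ) (trans (cong unpadˡ eq) eqˡ′) , trans (sym eqʳ) (trans (cong unpadʳ eq) eqʳ′)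

module Automata where

  open import Data.Nat using (zero; _∸_; _⊓_; _≤_; _<_)
  import Data.Nat.Properties as ℕ
  open import Data.Fin using (toℕ)
  open import Data.Fin.Properties using (pigeonhole; toℕ<n)
  open import Data.Product using (∃-syntax)
  open import Data.List using ([]; _∷_; _++_; map; take; drop; length; concat; replicate)
  import Data.List.Properties as List
  open import Relation.Binary.PropositionalEquality using (refl; sym; trans; cong; subst; module ≡-Reasoning)
  open ListLengths
  open DFA

  comap : {Σ₁ Σ₂ : Set} → (Σ₁ → Σ₂) → DFA Σ₂ → DFA Σ₁
  comap f M = record
    { nStates = nStates M ; start = start M ; step = λ q x → step M q (f x) ; accepting = accepting M }

  run-comap : {Σ₁ Σ₂ : Set} (f : Σ₁ → Σ₂) (M : DFA Σ₂) (q : Fin (nStates M)) (w : List Σ₁) →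
    run (comap f M) q w ≡ run M q (map f w)
  run-comap f M q []      = refl
  run-comap f M q (x ∷ w) = run-comap f M (step M q (f x)) w

  module _ {Σ′ : Set} (M : DFA Σ′) where

    run-++ : ∀ q (x y : List Σ′) → run M q (x ++ y) ≡ run M (run M q x) y
    run-++ q []      y = refl
    run-++ q (a ∷ x) y = run-++ (step M q a) x y

    run-concat-replicate : ∀ {q} (y : List Σ′) k → run M q y ≡ q → run M q (concat (replicate k y)) ≡ q
    run-concat-replicate     y zero    _    = refl
    run-concat-replicate {q} y (suc k) loop =
      trans (run-++ q y yᵏ) (trans (cong (λ p → run M p yᵏ) loop) (run-concat-replicate y k loop))
      where yᵏ = concat (replicate k y)

    loop-decomposition : ∀ q (w : List Σ′) → nStates M < length w →
      ∃[ x ] ∃[ y ] ∃[ z ] (w ≡ x ++ y ++ z × 0 < length y × run M q (x ++ y) ≡ run M q x)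
    loop-decomposition q w long
      with i , j , i<j , same ← pigeonhole (ℕ.n<1+n (nStates M)) (λ i → run M q (take (toℕ i) w)) =
      take a w , drop a (take b w) , drop b w , w≡ , 0<y , sym (trans same (cong (run M q) (sym xy≡)))
      where
      open ≡-Reasoning
      a = toℕ i
      b = toℕ j
      b≤w : b ≤ length w
      b≤w = ℕ.≤-trans (ℕ.≤-pred (toℕ<n j)) (ℕ.<⇒≤ long)
      xy≡ : take a w ++ drop a (take b w) ≡ take b w
      xy≡ = begin
        take a w ++ drop a (take b w)          ≡⟨ cong (λ m → take m w ++ drop a (take b w)) (ℕ.m≤n⇒m⊓n≡m (ℕ.<⇒≤ i<j)) ⟨
        take (a ⊓ b) w ++ drop a (take b w)    ≡⟨ cong (_++ drop a (take b w)) (List.take-take a b w) ⟨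
        take a (take b w) ++ drop a (take b w) ≡⟨ List.take++drop≡id a (take b w) ⟩
        take b w                               ∎
      w≡ : w ≡ take a w ++ drop a (take b w) ++ drop b w
      w≡ = sym (begin
        take a w ++ drop a (take b w) ++ drop b w   ≡⟨ List.++-assoc (take a w) _ _ ⟨
        (take a w ++ drop a (take b w)) ++ drop b w ≡⟨ cong (_++ drop b w) xy≡ ⟩
        take b w ++ drop b w                        ≡⟨ List.take++drop≡id b w ⟩
        w                                           ∎)
      0<y : 0 < length (drop a (take b w))
      0<y = subst (0 <_)
        (sym (trans (List.length-drop a (take b w))
                    (cong (_∸ a) (trans (List.length-take b w) (ℕ.m≤n⇒m⊓n≡m b≤w)))))
        (ℕ.m<n⇒0<n∸m i<j)

    pumping : ∀ q (w : List Σ′) → nStates M < length w →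
      ∀ k → ∃[ w′ ] (k ≤ length w′ × run M q w′ ≡ run M q w)
    pumping q w long k with loop-decomposition q w long
    ... | x , y , z , refl , 0<y , loop =
      x ++ yᵏ ++ z , ℕ.≤-trans (length-concat-replicate k y 0<y) (infix-length x yᵏ z) , same-run
      where
      open ≡-Reasoning
      yᵏ = concat (replicate k y)
      p = run M q x
      p-loop : run M p y ≡ p
      p-loop = trans (sym (run-++ q x y)) loop
      same-run : run M q (x ++ yᵏ ++ z) ≡ run M q (x ++ y ++ z)
      same-run = begin
        run M q (x ++ yᵏ ++ z)     ≡⟨ run-++ q x (yᵏ ++ z) ⟩
        run M p (yᵏ ++ z)          ≡⟨ run-++ p yᵏ z ⟩
        run M (run M p yᵏ) z       ≡⟨ cong (λ p′ → run M p′ z) (trans (run-concat-replicate y k p-loop) (sym p-loop)) ⟩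
        run M (run M p y) z        ≡⟨ run-++ p y z ⟨
        run M p (y ++ z)           ≡⟨ run-++ q x (y ++ z) ⟨
        run M q (x ++ y ++ z)      ∎

module SynchronizedRelations {ℓR : Level} {A B : Set} {R : Rel* {ℓR} A B}
  (D : DFA (PadLetter A B)) (D-recognizes : ∀ w → (DFA.accepts D w ≡ true) ⇔ padLang R w) where

  open import Data.Nat using (_+_; _≤_; _<_)
  import Data.Nat.Properties as ℕ
  open import Data.Product using (∃-syntax; proj₁; proj₂)
  open import Data.List using (_++_; map; zipWith; length)
  import Data.List.Properties as List
  open import Function.Bundles using (Equivalence)
  open import Relation.Nullary using (¬_)
  open import Relation.Binary.PropositionalEquality using (refl; cong; subst; module ≡-Reasoning)
  open ListLengths
  open Padding
  open Automata
  open DFA D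

  R⇒accepts : ∀ {u v} → R u v → accepts (pad u v) ≡ true
  R⇒accepts {u} {v} uRv = Equivalence.from (D-recognizes (pad u v)) (u , v , uRv , refl)

  accepts⇒R : ∀ {u v} → accepts (pad u v) ≡ true → R u v
  accepts⇒R {u} {v} acc with Equivalence.to (D-recognizes (pad u v)) acc
  ... | u₀ , v₀ , u₀Rv₀ , pad≡ with refl , refl ← pad-injective {u = u₀} {u} {v₀} {v} pad≡ = u₀Rv₀

  accepts-pad-leftPad : (u : List A) (w v : List B) → length v ≡ length u →
    accepts (pad u (w ++ v)) ≡ accepting (run (run start (map leftPad w)) (zipWith both u v))
  accepts-pad-leftPad u w v v≡u = cong accepting (begin
    run start (pad u (w ++ v))                            ≡⟨ cong (run start) (pad-leftPad u w v v≡u) ⟩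
    run start (map leftPad w ++ zipWith both u v)         ≡⟨ run-++ D start (map leftPad w) _ ⟩
    run (run start (map leftPad w)) (zipWith both u v)    ∎)
    where open ≡-Reasoning

  pumping-leftPad : ∀ {u w v} → R u (w ++ v) → length v ≡ length u → nStates < length w →
    ∀ k → ∃[ w′ ] (k ≤ length w′ × R u (w′ ++ v))
  pumping-leftPad {u} {w} {v} uRwv v≡u long k
    with w′ , k≤w′ , same-run ← pumping (comap leftPad D) start w long k =
    w′ , k≤w′ , accepts⇒R (begin
      accepts (pad u (w′ ++ v))                                         ≡⟨ accepts-pad-leftPad u w′ v v≡u ⟩
      accepting (run (run start (map leftPad w′)) (zipWith both u v))   ≡⟨ cong (λ q → accepting (run q (zipWith both u v))) leftPad-run ⟩
      accepting (run (run start (map leftPad w)) (zipWith both u v))    ≡⟨ accepts-pad-leftPad u w v v≡u ⟨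
      accepts (pad u (w ++ v))                                          ≡⟨ R⇒accepts uRwv ⟩
      true                                                              ∎)
    where
    open ≡-Reasoning
    leftPad-run : run start (map leftPad w′) ≡ run start (map leftPad w)
    leftPad-run = begin
      run start (map leftPad w′)         ≡⟨ run-comap leftPad D start w′ ⟨
      DFA.run (comap leftPad D) start w′ ≡⟨ same-run ⟩
      DFA.run (comap leftPad D) start w  ≡⟨ run-comap leftPad D start w ⟩
      run start (map leftPad w)          ∎

  image-not-long : FiniteImages R → ∀ {u v} → R u v → ¬ (nStates + length u < length v)
  image-not-long finite {u} {v} uRv long
    with w , v′ , refl , v′≡u ← suffix-of-length u v (ℕ.≤-trans (ℕ.m≤n+m (length u) nStates) (ℕ.<⇒≤ long)) =
    ℕ.<⇒≱ m<w′ (ℕ.≤-trans (ℕ.m≤m+n (length w′) (length v′))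
                          (subst (_≤ m) (List.length-++ w′) (vs-bounded (vs-complete _ uRw′v′))))
    where
    vs = proj₁ (finite u)
    vs-complete = proj₂ (finite u)
    m = proj₁ (lengths-bounded vs)
    vs-bounded = proj₂ (lengths-bounded vs)
    pumped = pumping-leftPad {u} {w} {v′} uRv v′≡u (prefix-longer nStates w v′ long v′≡u) (suc m)
    w′ = proj₁ pumped
    m<w′ = proj₁ (proj₂ pumped)
    uRw′v′ = proj₂ (proj₂ pumped)

  image-length-bound : FiniteImages R → ∀ {u v} → R u v → length v ≤ nStates + length u
  image-length-bound finite uRv = ℕ.≮⇒≥ (image-not-long finite uRv)

module LinearRepresentations {c ℓ : Level} (K : Semiring c ℓ) {B : Set} {r : ℕ}
  (μ : List B → SemiringDefs.Mat K (suc r)) (μ-hom : SemiringDefs.IsMonoidMorphism K μ)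
  (lam gam : Fin (suc r) → Semiring.Carrier K) where

  open import Data.Product using (proj₁; proj₂)
  open import Data.List using ([]; _++_)

  open Semiring K hiding (zero) renaming (Carrier to C)
  open SemiringDefs K
  open Matrices K
  open import Relation.Binary.Reasoning.Setoid setoid

  row : List B → Fin (suc r) → C
  row w = lam ◁ μ w

  column : List B → Fin (suc r) → C
  column v = μ v ▷ gam

  column-[] : ∀ i → column [] i ≈ gam i
  column-[] i = trans (▷-congˡ (proj₁ μ-hom) gam i) (I-· i gam)

  column-++ : ∀ w v i → column (w ++ v) i ≈ (μ w ▷ column v) i
  column-++ w v i = trans (▷-congˡ (proj₂ μ-hom w v) gam i) (⊗-▷ (μ w) (μ v) gam i)

  bilin-++ : ∀ w v → bilin lam (μ (w ++ v)) gam ≈ row w · column v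
  bilin-++ w v = begin
    bilin lam (μ (w ++ v)) gam ≈⟨ bilin-· lam (μ (w ++ v)) gam ⟩
    lam · column (w ++ v)      ≈⟨ ·-congʳ lam (column-++ w v) ⟩
    lam · (μ w ▷ column v)     ≈⟨ ◁-· lam (μ w) (column v) ⟨
    row w · column v           ∎

module Composition {ℓR c ℓ : Level} {A B : Set} (finite-B : Finite B) {R : Rel* {ℓR} A B}
  (D : DFA (PadLetter A B)) (D-recognizes : ∀ w → (DFA.accepts D w ≡ true) ⇔ padLang R w)
  (finite-images : FiniteImages R)
  (K : Semiring c ℓ) (S : SemiringDefs.Series K B) {r : ℕ}
  (μ : List B → SemiringDefs.Mat K (suc r)) (μ-hom : SemiringDefs.IsMonoidMorphism K μ)
  (lam gam : Fin (suc r) → Semiring.Carrier K)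
  (S-linear : ∀ v → Semiring._≈_ K (S v) (SemiringDefs.bilin K lam (μ v) gam)) where

  open import Function using (_∘_)
  open import Function.Bundles using (Equivalence; mk⇔)
  open import Data.Bool.Properties using (T-≡)
  open import Data.Nat using (zero)
  import Data.Nat as ℕ
  open import Data.Product using (proj₁; proj₂)
  open import Data.List using ([]; _∷_; _++_; map; zipWith; length; allFin; cartesianProductWith; filter)
  open import Data.List.Membership.Propositional using (_∈_)
  open import Data.List.Membership.Propositional.Properties
    using (∈-map⁺; ∈-allFin; ∈-++⁺ˡ; ∈-++⁺ʳ; ∈-cartesianProductWith⁺; ∈-filter⁺; ∈-filter⁻)
  open import Data.List.Membership.Propositional.Properties.WithK using (unique∧set⇒bag)
  open import Data.List.Relation.Binary.BagAndSetEquality using (_∼[_]_; set; ∼bag⇒↭)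
  open import Data.List.Relation.Unary.Any using (there)
  import Data.List.Relation.Unary.Unique.Propositional.Properties as Unique
  open import Relation.Nullary.Decidable using (T?)
  import Relation.Binary.PropositionalEquality as ≡

  open Semiring K hiding (zero) renaming (Carrier to C)
  open SemiringDefs K
  open FiniteSums K
  open Matrices K
  open WeightedAutomata K
  open LinearRepresentations K μ μ-hom lam gam
  open DFA D
  open SynchronizedRelations D D-recognizes
  open Padding
  open Enumerations
  open import Relation.Binary.Reasoning.Setoid setoid hiding (start)

  private
    enumeration-B = finite⇒enumeration finite-B

  bs : List B
  bs = proj₁ enumeration-B

  open Words bs (proj₁ (proj₂ enumeration-B)) (proj₂ (proj₂ enumeration-B))

  S-++ : ∀ w v → S (w ++ v) ≈ row w · column v
  S-++ w v = trans (S-linear (w ++ v)) (bilin-++ w v)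

  ∑-words-+ : ∀ m n (g : List B → C) →
    ∑[ v ∈ words (m ℕ.+ n) ] g v ≈ ∑[ w ∈ words m ] ∑[ v ∈ words n ] g (w ++ v)
  ∑-words-+ zero    n g = sym (+-identityʳ _)
  ∑-words-+ (suc m) n g = begin
    ∑ᴸ (cartesianProductWith _∷_ bs (words (m ℕ.+ n))) g
      ≈⟨ ∑ᴸ-cartesianProductWith _∷_ bs (words (m ℕ.+ n)) g ⟩
    ∑[ b ∈ bs ] ∑[ v ∈ words (m ℕ.+ n) ] g (b ∷ v)
      ≈⟨ ∑ᴸ-cong bs (λ {b} _ → ∑-words-+ m n (g ∘ (b ∷_))) ⟩
    ∑[ b ∈ bs ] ∑[ w ∈ words m ] ∑[ v ∈ words n ] g (b ∷ w ++ v)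
      ≈⟨ ∑ᴸ-cartesianProductWith _∷_ bs (words m) (λ w → ∑[ v ∈ words n ] g (w ++ v)) ⟨
    ∑[ w ∈ words (suc m) ] ∑[ v ∈ words n ] g (w ++ v) ∎

  data State : Set where
    waiting : Fin nStates → State
    reading : Fin nStates → Fin (suc r) → State

  states : List State
  states = map waiting (allFin nStates) ++ cartesianProductWith reading (allFin nStates) (allFin (suc r))

  ∈-states : ∀ x → x ∈ waiting start ∷ states
  ∈-states (waiting q)   = there (∈-++⁺ˡ (∈-map⁺ waiting (∈-allFin q)))
  ∈-states (reading q i) =
    there (∈-++⁺ʳ (map waiting (allFin nStates)) (∈-cartesianProductWith⁺ reading (∈-allFin q) (∈-allFin i)))

  enter : {Y : Set} → (Y → Fin (suc r) → C) → (Y → Fin nStates) → List Y → List (C × State)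
  enter ρ q ys = cartesianProductWith (λ y i → ρ y i , reading (q y) i) ys (allFin (suc r))

  δ : A → State → List (C × State)
  δ a (waiting q)   = (1# , waiting (step q (rightPad a))) ∷ enter (λ b → row (b ∷ [])) (λ b → step q (both a b)) bs
  δ a (reading q i) = enter (λ b → μ (b ∷ []) i) (λ b → step q (both a b)) bs

  final : State → C
  final (waiting q)   = S [] * 𝟙 (accepting q)
  final (reading q i) = gam i * 𝟙 (accepting q)

  -- The words w of length 1 … d guessed as the prefix of v read against $; d = nStates suffices.
  initialUpTo : ℕ → List (C × State)
  initialUpTo zero    = (1# , waiting start) ∷ []
  initialUpTo (suc d) = initialUpTo d ++ enter row (λ w → run start (map leftPad w)) (words (suc d))

  open Automaton (waiting start) states ∈-states δ final (initialUpTo nStates) public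

  future-reading : ∀ u q i →
    future u (reading q i) ≈ ∑[ v ∈ words (length u) ] column v i * 𝟙 (accepting (run q (zipWith both u v)))

  future-enter : {Y : Set} (ys : List Y) (ρ : Y → Fin (suc r) → C) (q : Y → Fin nStates) (u : List A) →
    ∑ᴸ (enter ρ q ys) (weighted (future u)) ≈
      ∑[ y ∈ ys ] ∑[ v ∈ words (length u) ] (ρ y · column v) * 𝟙 (accepting (run (q y) (zipWith both u v)))
  future-enter ys ρ q u = begin
    ∑ᴸ (enter ρ q ys) (weighted (future u))
      ≈⟨ ∑ᴸ-cartesianProductWith _ ys (allFin (suc r)) (weighted (future u)) ⟩
    ∑[ y ∈ ys ] ∑[ i ∈ allFin (suc r) ] ρ y i * future u (reading (q y) i)
      ≈⟨ ∑ᴸ-cong ys (λ {y} _ → reflexive (∑ᴸ-allFin (λ i → ρ y i * future u (reading (q y) i)))) ⟩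
    ∑[ y ∈ ys ] ρ y · (λ i → future u (reading (q y) i))
      ≈⟨ ∑ᴸ-cong ys (λ {y} _ → ·-congʳ (ρ y) (future-reading u (q y))) ⟩
    ∑[ y ∈ ys ] ρ y · (λ i → ∑[ v ∈ W ] column v i * 𝟙 (accepting (run (q y) (zipWith both u v))))
      ≈⟨ ∑ᴸ-cong ys (λ {y} _ → ·-distrib-∑ᴸ (ρ y) W column (λ v → 𝟙 (accepting (run (q y) (zipWith both u v))))) ⟩
    ∑[ y ∈ ys ] ∑[ v ∈ W ] (ρ y · column v) * 𝟙 (accepting (run (q y) (zipWith both u v))) ∎
    where W = words (length u)

  future-reading []      q i = begin
    gam i * 𝟙 (accepting q)             ≈⟨ *-congʳ (column-[] i) ⟨
    column [] i * 𝟙 (accepting q)       ≈⟨ +-identityʳ _ ⟨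
    column [] i * 𝟙 (accepting q) + 0#  ∎
  future-reading (a ∷ u) q i = begin
    ∑ᴸ (enter (λ b → μ (b ∷ []) i) qₐ bs) (weighted (future u))
      ≈⟨ future-enter bs (λ b → μ (b ∷ []) i) qₐ u ⟩
    ∑[ b ∈ bs ] ∑[ v ∈ W ] (μ (b ∷ []) i · column v) * 𝟙 (accepting (run (qₐ b) (zipWith both u v)))
      ≈⟨ ∑ᴸ-cong bs (λ {b} _ → ∑ᴸ-cong W (λ {v} _ → *-congʳ (column-++ (b ∷ []) v i))) ⟨
    ∑[ b ∈ bs ] ∑[ v ∈ W ] g (b ∷ v)
      ≈⟨ ∑ᴸ-cartesianProductWith _∷_ bs W g ⟨
    ∑ᴸ (words (suc (length u))) g ∎
    where
    W = words (length u)
    qₐ : B → Fin nStates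
    qₐ b = step q (both a b)
    g : List B → C
    g v = column v i * 𝟙 (accepting (run q (zipWith both (a ∷ u) v)))

  future-waiting : ∀ u q →
    future u (waiting q) ≈ ∑[ v ∈ wordsUpTo (length u) ] S v * 𝟙 (accepting (run q (pad u v)))
  future-waiting []      q = sym (+-identityʳ _)
  future-waiting (a ∷ u) q = begin
    1# * future u (waiting (step q (rightPad a))) + ∑ᴸ (enter (λ b → row (b ∷ [])) qₐ bs) (weighted (future u))
      ≈⟨ +-cong keep-waiting start-reading ⟩
    ∑ᴸ (wordsUpTo (length u)) g + ∑ᴸ (words (suc (length u))) g
      ≈⟨ ∑ᴸ-++ (wordsUpTo (length u)) (words (suc (length u))) g ⟨
    ∑ᴸ (wordsUpTo (suc (length u))) g ∎
    where
    W = words (length u)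
    qₐ : B → Fin nStates
    qₐ b = step q (both a b)
    g : List B → C
    g v = S v * 𝟙 (accepting (run q (pad (a ∷ u) v)))
    keep-waiting : 1# * future u (waiting (step q (rightPad a))) ≈ ∑ᴸ (wordsUpTo (length u)) g
    keep-waiting = trans (*-identityˡ _) (trans (future-waiting u (step q (rightPad a)))
      (∑ᴸ-cong (wordsUpTo (length u)) λ {v} v∈ → *-congˡ (reflexive (≡.cong (λ w → 𝟙 (accepting (run q w)))
        (≡.sym (pad-∷-rightPad a u v (∈-wordsUpTo⁻ (length u) v∈)))))))
    start-reading : ∑ᴸ (enter (λ b → row (b ∷ [])) qₐ bs) (weighted (future u)) ≈ ∑ᴸ (words (suc (length u))) g
    start-reading = begin
      ∑ᴸ (enter (λ b → row (b ∷ [])) qₐ bs) (weighted (future u))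
        ≈⟨ future-enter bs (λ b → row (b ∷ [])) qₐ u ⟩
      ∑[ b ∈ bs ] ∑[ v ∈ W ] (row (b ∷ []) · column v) * 𝟙 (accepting (run (qₐ b) (zipWith both u v)))
        ≈⟨ ∑ᴸ-cong bs (λ {b} _ → ∑ᴸ-cong W λ {v} v∈ → *-cong (sym (S-++ (b ∷ []) v))
             (reflexive (≡.cong (λ w → 𝟙 (accepting (run q w)))
               (≡.sym (pad-leftPad (a ∷ u) [] (b ∷ v) (≡.cong suc (∈-words⁻ (length u) v∈))))))) ⟩
      ∑[ b ∈ bs ] ∑[ v ∈ W ] g (b ∷ v)
        ≈⟨ ∑ᴸ-cartesianProductWith _∷_ bs W g ⟨
      ∑ᴸ (words (suc (length u))) g ∎

  future-enter-leftPad : ∀ m u →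
    ∑ᴸ (enter row (λ w → run start (map leftPad w)) (words m)) (weighted (future u)) ≈
      ∑[ v ∈ words (m ℕ.+ length u) ] S v * 𝟙 (accepts (pad u v))
  future-enter-leftPad m u = begin
    ∑ᴸ (enter row (λ w → run start (map leftPad w)) (words m)) (weighted (future u))
      ≈⟨ future-enter (words m) row (λ w → run start (map leftPad w)) u ⟩
    ∑[ w ∈ words m ] ∑[ v ∈ W ] (row w · column v) * 𝟙 (accepting (run (run start (map leftPad w)) (zipWith both u v)))
      ≈⟨ ∑ᴸ-cong (words m) (λ {w} _ → ∑ᴸ-cong W λ {v} v∈ → *-cong (sym (S-++ w v))
           (reflexive (≡.cong 𝟙 (≡.sym (accepts-pad-leftPad u w v (∈-words⁻ (length u) v∈)))))) ⟩
    ∑[ w ∈ words m ] ∑[ v ∈ W ] S (w ++ v) * 𝟙 (accepts (pad u (w ++ v)))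
      ≈⟨ ∑-words-+ m (length u) (λ v → S v * 𝟙 (accepts (pad u v))) ⟨
    ∑[ v ∈ words (m ℕ.+ length u) ] S v * 𝟙 (accepts (pad u v)) ∎
    where W = words (length u)

  initialUpTo-future : ∀ d u →
    ∑ᴸ (initialUpTo d) (weighted (future u)) ≈ ∑[ v ∈ wordsUpTo (d ℕ.+ length u) ] S v * 𝟙 (accepts (pad u v))
  initialUpTo-future zero    u = trans (+-identityʳ _) (trans (*-identityˡ _) (future-waiting u start))
  initialUpTo-future (suc d) u = begin
    ∑ᴸ (initialUpTo d ++ E) (weighted (future u))
      ≈⟨ ∑ᴸ-++ (initialUpTo d) E (weighted (future u)) ⟩
    ∑ᴸ (initialUpTo d) (weighted (future u)) + ∑ᴸ E (weighted (future u))
      ≈⟨ +-cong (initialUpTo-future d u) (future-enter-leftPad (suc d) u) ⟩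
    ∑ᴸ (wordsUpTo (d ℕ.+ length u)) g + ∑ᴸ (words (suc d ℕ.+ length u)) g
      ≈⟨ ∑ᴸ-++ (wordsUpTo (d ℕ.+ length u)) (words (suc d ℕ.+ length u)) g ⟨
    ∑ᴸ (wordsUpTo (suc d ℕ.+ length u)) g ∎
    where
    E = enter row (λ w → run start (map leftPad w)) (words (suc d))
    g : List B → C
    g v = S v * 𝟙 (accepts (pad u v))

  behaviour-isComposition : IsComposition S R behaviour
  behaviour-isComposition u vs vs-unique vs-exact = begin
    behaviour u                          ≈⟨ initialUpTo-future nStates u ⟩
    ∑[ v ∈ Vs ] S v * 𝟙 (accepted v)     ≈⟨ ∑ᴸ-filter accepted Vs S ⟩
    ∑ᴸ (filter (T? ∘ accepted) Vs) S     ≈⟨ ∑ᴸ-↭ S (∼bag⇒↭ (unique∧set⇒bag filtered-unique vs-unique same-elements)) ⟩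
    ∑ᴸ vs S                              ∎
    where
    Vs = wordsUpTo (nStates ℕ.+ length u)
    accepted : List B → _
    accepted v = accepts (pad u v)
    filtered-unique = Unique.filter⁺ (T? ∘ accepted) (wordsUpTo-unique (nStates ℕ.+ length u))
    same-elements : filter (T? ∘ accepted) Vs ∼[ set ] vs
    same-elements {v} = mk⇔
      (λ v∈ → Equivalence.from (vs-exact v) (accepts⇒R (Equivalence.to T-≡ (proj₂ (∈-filter⁻ (T? ∘ accepted) {xs = Vs} v∈)))))
      (λ v∈ → let uRv = Equivalence.to (vs-exact v) v∈ in
        ∈-filter⁺ (T? ∘ accepted) (∈-wordsUpTo⁺ _ (image-length-bound finite-images uRv)) (Equivalence.from T-≡ (R⇒accepts uRv)))

theorem9p2 : {c ℓ ℓR : Level} (A B : Set) → Finite A → Finite B →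
    (K : Semiring c ℓ) → (R : Rel* {ℓR} A B) → Synchronized R → FiniteImages R →
    (S : SemiringDefs.Series K B) → SemiringDefs.Recognizable K S →
    Σ (SemiringDefs.Series K A) λ T →
      SemiringDefs.IsComposition K S R T × SemiringDefs.Recognizable K T
theorem9p2 A B _ finite-B K R (D , D-recognizes) finite-images S (_ , μ , μ-hom , lam , gam , S-linear) =
  behaviour , behaviour-isComposition , behaviour-recognizable
  where open Composition finite-B D D-recognizes finite-images K S μ μ-hom lam gam S-linear
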